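{- Let $G$ be a graph with $|E(G)| \geq 3$ and let $G'$ be the simple graph obtained from $G$ by contracting an edge. Then $\mathrm{simw}(L(G)) \geq \mathrm{simw}(L(G'))$.
   Context: All graphs are finite and simple. Contracting an edge $uv$ deletes $u$ and $v$ and adds a new vertex adjacent to every vertex of $(N(u)\setminus\{v\})\cup(N(v)\setminus\{u\})$ (so the result is simple). $L(G)$ is the line graph. A branch decomposition of $H$ is a pair $(T,\delta)$ with $T$ a tree of maximum degree at most $3$ and $\delta$ a bijection from $V(H)$ to the leaves of $T$; each tree edge $e$ induces a bipartition $(A_e,\overline{A_e})$ of $V(H)$. $\mathrm{cutsim}_H(X)$ is the maximum size of a matching of $H$ whose edges each join $X$ to $V(H)\setminus X$ and which is an induced matching of $H$; $\mathrm{simw}(H)$ is the minimum over branch decompositions of $\max_e\mathrm{cutsim}_H(A_e)$, and $0$ if $|V(H)|\le 1$. -}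

module Defs where

open import Data.Nat using (ℕ; zero; suc; _+_; _≤_)
open import Data.Bool using (Bool; true; false)
open import Data.Fin using (Fin; _<_)
open import Data.List using (List; []; _∷_; _++_; length; map; allFin)
open import Data.Nat.ListAction using (sum)
open import Data.List.Relation.Unary.AllPairs using (AllPairs)
open import Data.List.Relation.Unary.All using (All)
open import Data.List.Relation.Unary.Unique.Propositional using (Unique)
open import Data.List.Relation.Unary.Linked using (Linked)
open import Data.Product using (Σ; ∃; _×_; _,_; proj₁; proj₂)
open import Data.Sum using (_⊎_)
open import Relation.Binary.PropositionalEquality using (_≡_; _≢_)
open import Relation.Nullary using (¬_)

record SimpleGraph (n : ℕ) : Set where
  field
    adj    : Fin n → Fin n → Bool
    sym    : ∀ i j → adj i j ≡ adj j i
    irrefl : ∀ i → adj i i ≡ false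
open SimpleGraph public

Adj : ∀ {n} → SimpleGraph n → Fin n → Fin n → Set
Adj G i j = adj G i j ≡ true

b2n : Bool → ℕ
b2n true  = 1
b2n false = 0

deg : ∀ {n} → SimpleGraph n → Fin n → ℕ
deg {n} G i = sum (map (λ j → b2n (adj G i j)) (allFin n))

record Edge {n : ℕ} (G : SimpleGraph n) : Set where
  constructor edge
  field
    fst    : Fin n
    snd    : Fin n
    ord    : fst < snd
    isEdge : Adj G fst snd
open Edge public

LAdj : ∀ {n} (G : SimpleGraph n) → Edge G → Edge G → Set
LAdj G e f = e ≢ f × (fst e ≡ fst f ⊎ fst e ≡ snd f ⊎ snd e ≡ fst f ⊎ snd e ≡ snd f)

AtLeastThreeEdges : ∀ {n} → SimpleGraph n → Set
AtLeastThreeEdges G = Σ (Edge G) λ e₁ → Σ (Edge G) λ e₂ → Σ (Edge G) λ e₃ →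
  e₁ ≢ e₂ × e₁ ≢ e₃ × e₂ ≢ e₃

-- Contraction of an edge uv (result taken up to isomorphism):
-- G' is the contraction of uv in G iff there is a surjection φ from V(G)
-- onto V(G') identifying exactly u and v, and a,b are adjacent in G'
-- iff a ≠ b and some x ∈ φ⁻¹(a), y ∈ φ⁻¹(b) are adjacent in G.

IsEdgeContraction : ∀ {n n'} → SimpleGraph n → SimpleGraph n' → Set
IsEdgeContraction {n} {n'} G G' =
  Σ (Fin n) λ u → Σ (Fin n) λ v → Adj G u v ×
  Σ (Fin n → Fin n') λ φ →
      (∀ a → ∃ λ x → φ x ≡ a)
    × φ u ≡ φ v
    × (∀ x y → φ x ≡ φ y → x ≡ y ⊎ ((x ≡ u ⊎ x ≡ v) × (y ≡ u ⊎ y ≡ v)))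
    × (∀ a b → (Adj G' a b → a ≢ b × ∃ λ x → ∃ λ y → φ x ≡ a × φ y ≡ b × Adj G x y)
             × (a ≢ b × (∃ λ x → ∃ λ y → φ x ≡ a × φ y ≡ b × Adj G x y) → Adj G' a b))

data WalkAvoiding {t} (T : SimpleGraph t) (a b : Fin t) : Fin t → Fin t → Set where
  here : ∀ {x} → WalkAvoiding T a b x x
  step : ∀ {x y z} → Adj T x y → ¬ ((x ≡ a × y ≡ b) ⊎ (x ≡ b × y ≡ a)) →
         WalkAvoiding T a b y z → WalkAvoiding T a b x z

data Walk {t} (T : SimpleGraph t) : Fin t → Fin t → Set where
  here : ∀ {x} → Walk T x x
  step : ∀ {x y z} → Adj T x y → Walk T y z → Walk T x z

Connected : ∀ {t} → SimpleGraph t → Set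
Connected T = ∀ x y → Walk T x y

HasCycle : ∀ {t} → SimpleGraph t → Set
HasCycle {t} T = Σ (Fin t) λ x → Σ (List (Fin t)) λ cs →
  2 ≤ length cs × Unique (x ∷ cs) × Linked (Adj T) (x ∷ cs ++ x ∷ [])

IsTree : ∀ {t} → SimpleGraph t → Set
IsTree T = Connected T × ¬ HasCycle T

IsLeaf : ∀ {t} → SimpleGraph t → Fin t → Set
IsLeaf T i = deg T i ≡ 1

record BranchDecomposition (V : Set) : Set where
  field
    t      : ℕ
    T      : SimpleGraph t
    tree   : IsTree T
    maxdeg : ∀ i → deg T i ≤ 3
    δ      : V → Fin t
    δ-inj  : ∀ x y → δ x ≡ δ y → x ≡ y
    δ-leaf : ∀ x → IsLeaf T (δ x)
    δ-onto : ∀ i → IsLeaf T i → ∃ λ x → δ x ≡ i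
open BranchDecomposition public

-- side A_e of the tree edge e = ab: the vertices of H whose leaf is
-- connected to a in T - e
Side : ∀ {V} (D : BranchDecomposition V) → Fin (t D) → Fin (t D) → V → Set
Side D a b x = WalkAvoiding (T D) a b (δ D x) a

CrossEdge : {V : Set} (_~_ : V → V → Set) (X : V → Set) → V × V → Set
CrossEdge _~_ X (p , q) = X p × ¬ X q × p ~ q

Separated : {V : Set} (_~_ : V → V → Set) → V × V → V × V → Set
Separated _~_ (p , q) (p' , q') =
    p ≢ p' × p ≢ q' × q ≢ p' × q ≢ q'
  × ¬ (p ~ p') × ¬ (p ~ q') × ¬ (q ~ p') × ¬ (q ~ q')

IsInducedCrossMatching : {V : Set} (_~_ : V → V → Set) (X : V → Set) → List (V × V) → Set
IsInducedCrossMatching _~_ X M = All (CrossEdge _~_ X) M × AllPairs (Separated _~_) M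

CutsimLE : {V : Set} (_~_ : V → V → Set) (X : V → Set) → ℕ → Set
CutsimLE {V} _~_ X k = ∀ (M : List (V × V)) → IsInducedCrossMatching _~_ X M → length M ≤ k

SimwLE : (V : Set) (_~_ : V → V → Set) → ℕ → Set
SimwLE V _~_ k = (∀ (x y : V) → x ≡ y)
  ⊎ Σ (BranchDecomposition V) λ D →
      ∀ a b → Adj (T D) a b → CutsimLE _~_ (Side D a b) k

simwLineLE : ∀ {n} → SimpleGraph n → ℕ → Set
simwLineLE G k = SimwLE (Edge G) (LAdj G) k

{-# OPTIONS --safe #-}
-- For every edge r of G′ choose an edge ψ r of G lying over it; ψ is injective. Relabelling the
-- leaves of a branch decomposition of L(G) along ψ and pruning the leaves left without a label
-- gives a branch decomposition of L(G′) each of whose cuts is the ψ-preimage of a cut of the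
-- original one. An induced matching of L(G′) across such a cut lifts edgewise along ψ to an induced
-- matching of L(G) across the original cut, except that a matching edge pq whose lifts are not
-- adjacent must meet the contracted vertex; at most one matching edge does, and it is replaced by
-- the pair formed by the edge uv and the lift lying on the other side of the cut from uv.
module Submission where

open import Defs renaming (sym to adj-sym)
open import Axiom.UniquenessOfIdentityProofs using (module Decidable⇒UIP)
open import Data.Bool using (true; false)
import Data.Bool as Bool
open import Data.Fin using (Fin; zero; suc; punchIn; punchOut; _<_)
open import Data.Fin.Properties
  using (punchIn-injective; punchInᵢ≢i; punchIn-punchOut; _≟_; any?; _<?_; <-cmp; <⇒≢; <-irrelevant; <-irrefl; <-trans)
open import Data.List using ([]; _∷_; map; tabulate; length)
open import Data.List.Properties using (map-tabulate; length-map; map-++)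
open import Data.List.Relation.Unary.All using (All; []; _∷_)
import Data.List.Relation.Unary.All as All
import Data.List.Relation.Unary.All.Properties as All
open import Data.List.Relation.Unary.AllPairs using (AllPairs; []; _∷_)
open import Data.List.Relation.Unary.Linked using (Linked)
import Data.List.Relation.Unary.Linked.Properties as Linked
import Data.List.Relation.Unary.Unique.Propositional.Properties as Unique
open import Data.Nat using (ℕ; zero; suc; _+_; _≤_; s≤s)
open import Data.Nat.ListAction using (sum)
open import Data.Nat.Properties
  using (+-0-commutativeMonoid; _≤?_; m≤m+n; m≤n+m; +-monoʳ-≤; ≤-trans; module ≤-Reasoning) renaming (_≟_ to _≟ℕ_)
open import Data.Product using (Σ; ∃; _×_; _,_; proj₁; proj₂)
import Data.Product as Prod
open import Data.Sum using (_⊎_; inj₁; inj₂; [_,_]′)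
import Data.Sum as Sum
open import Function using (_∘_; id; case_of_)
open import Function.Bundles using (_⇔_; mk⇔; module Equivalence)
open import Function.Construct.Composition using (_⇔-∘_)
open import Function.Construct.Identity using (⇔-id)
open import Relation.Binary.Definitions using (DecidableEquality; tri<; tri≈; tri>)
open import Relation.Binary.PropositionalEquality
open import Relation.Nullary using (¬_; Dec; yes; no; contradiction)
open import Relation.Nullary.Decidable using (_×-dec_; _⊎-dec_; ¬?; decidable-stable; ¬¬-excluded-middle)
import Relation.Nullary.Decidable as Dec
open import Algebra.Properties.CommutativeMonoid.Sum +-0-commutativeMonoid using (sum-remove) renaming (sum to ∑)

open Equivalence using (to; from)

sum-tabulate : ∀ {t} (h : Fin t → ℕ) → sum (tabulate h) ≡ ∑ h
sum-tabulate {zero}  h = refl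
sum-tabulate {suc t} h = cong (h zero +_) (sum-tabulate (h ∘ suc))

≤-∑ : ∀ {t} (h : Fin t → ℕ) j → h j ≤ ∑ h
≤-∑ {suc t} h j = subst (h j ≤_) (sym (sum-remove h)) (m≤m+n (h j) _)

module _ {n : ℕ} (G : SimpleGraph n) where

  deg≡∑ : ∀ i → deg G i ≡ ∑ (λ j → b2n (adj G i j))
  deg≡∑ i = trans (cong sum (map-tabulate id (λ j → b2n (adj G i j)))) (sum-tabulate (λ j → b2n (adj G i j)))

  Adj-sym : ∀ {i j} → Adj G i j → Adj G j i
  Adj-sym {i} {j} = trans (adj-sym G j i)

  Adj⇒≢ : ∀ {i j} → Adj G i j → i ≢ j
  Adj⇒≢ {i} ii refl with trans (sym ii) (irrefl G i)
  ... | ()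

deg-punchIn : ∀ {n} (G : SimpleGraph (suc n)) i ℓ →
  deg G i ≡ b2n (adj G i ℓ) + ∑ (λ j → b2n (adj G i (punchIn ℓ j)))
deg-punchIn G i ℓ = trans (deg≡∑ G i) (sum-remove {i = ℓ} (λ j → b2n (adj G i j)))

leaf-neighbour-unique : ∀ {n} (G : SimpleGraph n) {i j k} →
  IsLeaf G i → Adj G i j → Adj G i k → j ≡ k
leaf-neighbour-unique {suc n} G {i} {j} {k} leaf ij ik with j ≟ k
... | yes j≡k = j≡k
... | no j≢k = contradiction (subst (2 ≤_) leaf two≤deg) λ { (s≤s ()) }
  where
  open ≤-Reasoning
  k′ : Fin n
  k′ = punchOut j≢k
  ik′ : Adj G i (punchIn j k′)
  ik′ = subst (Adj G i) (sym (punchIn-punchOut j≢k)) ik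
  two≤deg : 2 ≤ deg G i
  two≤deg = begin
    2                                                  ≡⟨ cong₂ (λ a b → b2n a + b2n b) ij ik′ ⟨
    b2n (adj G i j) + b2n (adj G i (punchIn j k′))     ≤⟨ +-monoʳ-≤ _ (≤-∑ _ k′) ⟩
    b2n (adj G i j) + ∑ (λ m → b2n (adj G i (punchIn j m)))  ≡⟨ deg-punchIn G i j ⟨
    deg G i                                            ∎

SamePair : {A : Set} → A → A → A → A → Set
SamePair a b x y = (x ≡ a × y ≡ b) ⊎ (x ≡ b × y ≡ a)

SamePair-sym : ∀ {A : Set} {a b x y : A} → SamePair a b x y → SamePair x y a b
SamePair-sym (inj₁ (refl , refl)) = inj₁ (refl , refl)
SamePair-sym (inj₂ (refl , refl)) = inj₂ (refl , refl)

SamePair-trans : ∀ {A : Set} {a b x y c d : A} → SamePair a b x y → SamePair x y c d → SamePair a b c d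
SamePair-trans (inj₁ (refl , refl)) xy≈cd                = xy≈cd
SamePair-trans (inj₂ (refl , refl)) (inj₁ (refl , refl)) = inj₂ (refl , refl)
SamePair-trans (inj₂ (refl , refl)) (inj₂ (refl , refl)) = inj₁ (refl , refl)

SamePair-∈ : ∀ {A : Set} {a b x y z : A} → SamePair a b x y → x ≡ z ⊎ y ≡ z → a ≡ z ⊎ b ≡ z
SamePair-∈ (inj₁ (refl , refl)) = id
SamePair-∈ (inj₂ (refl , refl)) = Sum.swap

SamePair-map : ∀ {A B : Set} (f : A → B) {a b x y} →
  SamePair a b x y → SamePair (f a) (f b) (f x) (f y)
SamePair-map f = Sum.map (Prod.map (cong f) (cong f)) (Prod.map (cong f) (cong f))

SamePair-injective : ∀ {A B : Set} {f : A → B} → (∀ {x y} → f x ≡ f y → x ≡ y) → ∀ {a b x y} →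
  SamePair (f a) (f b) (f x) (f y) → SamePair a b x y
SamePair-injective inj = Sum.map (Prod.map inj inj) (Prod.map inj inj)

module _ {n : ℕ} {G : SimpleGraph n} where

  Walk⇒WalkAvoiding : ∀ z {x y} → Walk G x y → WalkAvoiding G z z x y
  Walk⇒WalkAvoiding z here         = here
  Walk⇒WalkAvoiding z (step xy w) = step xy (Adj⇒≢ G xy ∘ loop) (Walk⇒WalkAvoiding z w)
    where
    loop : ∀ {x y} → SamePair z z x y → x ≡ y
    loop = [ (λ (p , q) → trans p (sym q)) , (λ (p , q) → trans p (sym q)) ]′

  WalkAvoiding⇒Walk : ∀ {a b x y} → WalkAvoiding G a b x y → Walk G x y
  WalkAvoiding⇒Walk here         = here
  WalkAvoiding⇒Walk (step xy _ w) = step xy (WalkAvoiding⇒Walk w)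

  -- A walk leaving the leaf x or y can only move to the other one.
  adjacent-leaves-cover : Connected G → ∀ {x y} → IsLeaf G x → IsLeaf G y → Adj G x y →
    ∀ z → z ≡ x ⊎ z ≡ y
  adjacent-leaves-cover connected {x} {y} leafˣ leafʸ xy z = go (connected x z) (inj₁ refl)
    where
    go : ∀ {s z} → Walk G s z → s ≡ x ⊎ s ≡ y → z ≡ x ⊎ z ≡ y
    go here           s∈xy          = s∈xy
    go (step sm w) (inj₁ refl) = go w (inj₂ (leaf-neighbour-unique G leafˣ sm xy))
    go (step sm w) (inj₂ refl) = go w (inj₁ (leaf-neighbour-unique G leafʸ sm (Adj-sym G xy)))

removeVertex : ∀ {t} → SimpleGraph (suc t) → Fin (suc t) → SimpleGraph t
removeVertex T ℓ = record
  { adj    = λ i j → adj T (punchIn ℓ i) (punchIn ℓ j)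
  ; sym    = λ i j → adj-sym T (punchIn ℓ i) (punchIn ℓ j)
  ; irrefl = λ i → irrefl T (punchIn ℓ i)
  }

module _ {t : ℕ} (T : SimpleGraph (suc t)) (ℓ : Fin (suc t)) where

  private
    T-ℓ : SimpleGraph t
    T-ℓ = removeVertex T ℓ

    ↑ : Fin t → Fin (suc t)
    ↑ = punchIn ℓ

    ↑-injective : ∀ {x y} → ↑ x ≡ ↑ y → x ≡ y
    ↑-injective = punchIn-injective ℓ _ _

  deg-removeVertex : ∀ i → deg T (↑ i) ≡ b2n (adj T (↑ i) ℓ) + deg T-ℓ i
  deg-removeVertex i = trans (deg-punchIn T (↑ i) ℓ) (cong (b2n (adj T (↑ i) ℓ) +_) (sym (deg≡∑ T-ℓ i)))

  deg-removeVertex-≤ : ∀ i → deg T-ℓ i ≤ deg T (↑ i)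
  deg-removeVertex-≤ i = subst (deg T-ℓ i ≤_) (sym (deg-removeVertex i)) (m≤n+m _ _)

  WalkAvoiding-punchIn : ∀ {a b x y} → WalkAvoiding T-ℓ a b x y → WalkAvoiding T (↑ a) (↑ b) (↑ x) (↑ y)
  WalkAvoiding-punchIn here             = here
  WalkAvoiding-punchIn (step xy avoid w) =
    step xy (avoid ∘ SamePair-injective ↑-injective) (WalkAvoiding-punchIn w)

  HasCycle-punchIn : HasCycle T-ℓ → HasCycle T
  HasCycle-punchIn (x , cs , long , distinct , linked) =
      ↑ x , map ↑ cs
    , subst (2 ≤_) (sym (length-map ↑ cs)) long
    , Unique.map⁺ ↑-injective distinct
    , subst (Linked (Adj T)) (cong (↑ x ∷_) (map-++ ↑ cs (x ∷ []))) (Linked.map⁺ linked)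

  module _ (leaf : IsLeaf T ℓ) where

    -- A walk entering the leaf ℓ leaves it again through the same edge, so ℓ can be skipped.
    WalkAvoiding-punchOut : ∀ {a b c d} → WalkAvoiding T (↑ a) (↑ b) c d →
      ∀ {x y} → c ≡ ↑ x → d ≡ ↑ y → WalkAvoiding T-ℓ a b x y
    WalkAvoiding-punchOut here refl d≡ = subst (WalkAvoiding T-ℓ _ _ _) (↑-injective d≡) here
    WalkAvoiding-punchOut (step {y = m} cm avoid w) c≡ d≡ with ℓ ≟ m
    ... | no ℓ≢m = step (subst₂ (Adj T) c≡ m≡ cm) (avoid ∘ subst₂ (SamePair _ _) (sym c≡) (sym m≡) ∘ SamePair-map ↑)
                        (WalkAvoiding-punchOut w m≡ d≡)
      where
      m≡ : m ≡ ↑ (punchOut ℓ≢m)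
      m≡ = sym (punchIn-punchOut ℓ≢m)
    WalkAvoiding-punchOut (step cm _ here)          _  d≡ | yes refl = contradiction (sym d≡) (punchInᵢ≢i ℓ _)
    WalkAvoiding-punchOut (step cm _ (step ℓm _ w)) c≡ d≡ | yes refl =
      WalkAvoiding-punchOut w (trans (leaf-neighbour-unique T leaf ℓm (Adj-sym T cm)) c≡) d≡

    removeLeaf-connected : Connected T → Connected T-ℓ
    removeLeaf-connected connected x y =
      WalkAvoiding⇒Walk (WalkAvoiding-punchOut (Walk⇒WalkAvoiding (↑ x) (connected (↑ x) (↑ y))) refl refl)

SideOf : ∀ {W : Set} {t} → SimpleGraph t → (W → Fin t) → Fin t → Fin t → W → Set
SideOf T δ a b w = WalkAvoiding T a b (δ w) a

CutsEmbed : ∀ {W : Set} {t′ t} → SimpleGraph t′ → (W → Fin t′) → SimpleGraph t → (W → Fin t) → Set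
CutsEmbed {t = t} T′ δ′ T δ = ∀ a b → Adj T′ a b → Σ (Fin t) λ a′ → Σ (Fin t) λ b′ →
  Adj T a′ b′ × (∀ w → SideOf T′ δ′ a b w ⇔ SideOf T δ a′ b′ w)

CutsEmbed-trans : ∀ {W : Set} {t₁ t₂ t₃} {T₁ : SimpleGraph t₁} {T₂ : SimpleGraph t₂} {T₃ : SimpleGraph t₃}
  {δ₁ : W → Fin t₁} {δ₂ : W → Fin t₂} {δ₃ : W → Fin t₃} →
  CutsEmbed T₁ δ₁ T₂ δ₂ → CutsEmbed T₂ δ₂ T₃ δ₃ → CutsEmbed T₁ δ₁ T₃ δ₃
CutsEmbed-trans embed₁₂ embed₂₃ a b ab =
  let (a₂ , b₂ , ab₂ , side₁₂) = embed₁₂ a b ab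
      (a₃ , b₃ , ab₃ , side₂₃) = embed₂₃ a₂ b₂ ab₂
  in a₃ , b₃ , ab₃ , λ w → side₂₃ w ⇔-∘ side₁₂ w

record PartialBranchDecomposition (W : Set) (t : ℕ) : Set where
  field
    graph      : SimpleGraph t
    isTree     : IsTree graph
    subcubic   : ∀ i → deg graph i ≤ 3
    label      : W → Fin t
    label-inj  : ∀ x y → label x ≡ label y → x ≡ y
    label-leaf : ∀ x → IsLeaf graph (label x)
    labelled?  : ∀ i → Dec (∃ λ w → label w ≡ i)

open PartialBranchDecomposition

module _ {W : Set} {t : ℕ} (P : PartialBranchDecomposition W (suc t)) {w₁ w₂ : W} (w₁≢w₂ : w₁ ≢ w₂)
         {ℓ : Fin (suc t)} (leaf : IsLeaf (graph P) ℓ) (unlabelled : ¬ ∃ λ w → label P w ≡ ℓ) where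

  private
    Tr : SimpleGraph (suc t)
    Tr = graph P

    Tr-ℓ : SimpleGraph t
    Tr-ℓ = removeVertex Tr ℓ

    ↑ : Fin t → Fin (suc t)
    ↑ = punchIn ℓ

    ℓ≢label : ∀ w → ℓ ≢ label P w
    ℓ≢label w ℓ≡ = unlabelled (w , sym ℓ≡)

    label′ : W → Fin t
    label′ w = punchOut (ℓ≢label w)

    ↑label′ : ∀ w → ↑ (label′ w) ≡ label P w
    ↑label′ w = punchIn-punchOut (ℓ≢label w)

  -- Otherwise ℓ and that labelled leaf would make up the whole tree, which then has a single label.
  labelled-nonadjacent-unlabelled : ∀ w → adj Tr (label P w) ℓ ≡ false
  labelled-nonadjacent-unlabelled w with adj Tr (label P w) ℓ in wℓ
  ... | false = refl
  ... | true  = contradiction (trans (only w₁) (sym (only w₂))) w₁≢w₂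
    where
    only : ∀ x → x ≡ w
    only x with adjacent-leaves-cover (proj₁ (isTree P)) (label-leaf P w) leaf wℓ (label P x)
    ... | inj₁ x≡w = label-inj P x w x≡w
    ... | inj₂ x≡ℓ = contradiction (x , x≡ℓ) unlabelled

  labelled-leaf-survives : ∀ w → IsLeaf Tr-ℓ (label′ w)
  labelled-leaf-survives w = begin
    deg Tr-ℓ (label′ w)                                 ≡⟨ cong (λ b → b2n b + deg Tr-ℓ (label′ w)) (labelled-nonadjacent-unlabelled w) ⟨
    b2n (adj Tr (label P w) ℓ) + deg Tr-ℓ (label′ w)     ≡⟨ cong (λ z → b2n (adj Tr z ℓ) + deg Tr-ℓ (label′ w)) (↑label′ w) ⟨
    b2n (adj Tr (↑ (label′ w)) ℓ) + deg Tr-ℓ (label′ w) ≡⟨ deg-removeVertex Tr ℓ (label′ w) ⟨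
    deg Tr (↑ (label′ w))                               ≡⟨ cong (deg Tr) (↑label′ w) ⟩
    deg Tr (label P w)                                  ≡⟨ label-leaf P w ⟩
    1                                                   ∎
    where open ≡-Reasoning

  removeUnlabelledLeaf : Σ (PartialBranchDecomposition W t) λ P′ → CutsEmbed (graph P′) (label P′) Tr (label P)
  removeUnlabelledLeaf = P′ , embed
    where
    P′ : PartialBranchDecomposition W t
    P′ = record
      { graph      = Tr-ℓ
      ; isTree     = removeLeaf-connected Tr ℓ leaf (proj₁ (isTree P)) , proj₂ (isTree P) ∘ HasCycle-punchIn Tr ℓ
      ; subcubic   = λ i → ≤-trans (deg-removeVertex-≤ Tr ℓ i) (subcubic P (↑ i))
      ; label      = label′
      ; label-inj  = λ x y eq → label-inj P x y (trans (sym (↑label′ x)) (trans (cong ↑ eq) (↑label′ y)))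
      ; label-leaf = labelled-leaf-survives
      ; labelled?  = λ i → Dec.map′ (Prod.map₂ λ {w} eq → punchIn-injective ℓ _ _ (trans (↑label′ w) eq))
                                     (Prod.map₂ λ {w} eq → trans (sym (↑label′ w)) (cong ↑ eq))
                                     (labelled? P (↑ i))
      }
    embed : CutsEmbed Tr-ℓ label′ Tr (label P)
    embed a b ab = ↑ a , ↑ b , ab , λ w → mk⇔
      (subst (λ z → WalkAvoiding Tr (↑ a) (↑ b) z (↑ a)) (↑label′ w) ∘ WalkAvoiding-punchIn Tr ℓ)
      (λ side → WalkAvoiding-punchOut Tr ℓ leaf side (sym (↑label′ w)) refl)

prune : ∀ {W : Set} {w₁ w₂ : W} → w₁ ≢ w₂ → ∀ t (P : PartialBranchDecomposition W t) →
  Σ (BranchDecomposition W) λ D → CutsEmbed (T D) (δ D) (graph P) (label P)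
prune {w₁ = w₁} w₁≢w₂ zero P with label P w₁
... | ()
prune w₁≢w₂ (suc t) P with any? (λ i → (deg (graph P) i ≟ℕ 1) ×-dec ¬? (labelled? P i))
... | yes (ℓ , leaf , unlabelled) =
  let (P′ , embed) = removeUnlabelledLeaf P w₁≢w₂ leaf unlabelled
      (D , embed′) = prune w₁≢w₂ t P′
  in D , CutsEmbed-trans embed′ embed
... | no noUnlabelledLeaf = D , λ a b ab → a , b , ab , λ w → ⇔-id _
  where
  labelled : ∀ i → IsLeaf (graph P) i → ∃ λ w → label P w ≡ i
  labelled i leaf with labelled? P i
  ... | yes found     = found
  ... | no unlabelled = contradiction (i , leaf , unlabelled) noUnlabelledLeaf
  D : BranchDecomposition _
  D = record { t = suc t ; T = graph P ; tree = isTree P ; maxdeg = subcubic P ; δ = label P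
             ; δ-inj = label-inj P ; δ-leaf = label-leaf P ; δ-onto = labelled }

Searchable : Set → Set₁
Searchable A = ∀ (P : A → Set) → (∀ x → Dec (P x)) → Dec (∃ P)

restrictDecomposition : ∀ {W W′ : Set} (D : BranchDecomposition W) (ψ : W′ → W) →
  (∀ {x y} → ψ x ≡ ψ y → x ≡ y) → Searchable W′ → {w₁ w₂ : W′} → w₁ ≢ w₂ →
  Σ (BranchDecomposition W′) λ D′ → CutsEmbed (T D′) (δ D′) (T D) (δ D ∘ ψ)
restrictDecomposition D ψ ψ-inj search w₁≢w₂ = prune w₁≢w₂ (t D) record
  { graph      = T D
  ; isTree     = tree D
  ; subcubic   = maxdeg D
  ; label      = δ D ∘ ψ
  ; label-inj  = λ x y eq → ψ-inj (δ-inj D _ _ eq)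
  ; label-leaf = δ-leaf D ∘ ψ
  ; labelled?  = λ i → search _ (λ w → δ D (ψ w) ≟ i)
  }

SimwLE-reflect : ∀ {V V′ : Set} {_~_ : V → V → Set} {_~′_ : V′ → V′ → Set} {k}
  (ψ : V′ → V) → (∀ {x y} → ψ x ≡ ψ y → x ≡ y) → DecidableEquality V′ → Searchable V′ →
  (∀ X X′ → (∀ w → X′ w ⇔ X (ψ w)) → CutsimLE _~_ X k → CutsimLE _~′_ X′ k) →
  SimwLE V _~_ k → SimwLE V′ _~′_ k
SimwLE-reflect ψ ψ-inj _≟′_ search transfer (inj₁ trivial) = inj₁ λ x y → ψ-inj (trivial (ψ x) (ψ y))
SimwLE-reflect ψ ψ-inj _≟′_ search transfer (inj₂ (D , cuts))
  with search (λ x → ∃ λ y → x ≢ y) (λ x → search _ (λ y → ¬? (x ≟′ y)))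
... | no noPair = inj₁ λ x y → decidable-stable (x ≟′ y) (λ x≢y → noPair (x , y , x≢y))
... | yes (w₁ , w₂ , w₁≢w₂) =
  let (D′ , embed) = restrictDecomposition D ψ ψ-inj search w₁≢w₂
  in inj₂ (D′ , λ a b ab → let (a′ , b′ , ab′ , sides) = embed a b ab
                           in transfer _ _ sides (cuts a′ b′ ab′))

Far : {V : Set} → (V → V → Set) → V → V → Set
Far _~_ x y = x ≢ y × ¬ x ~ y

AllPairs-map⁺ : ∀ {A B : Set} {P : A → Set} {R : A → A → Set} {S : B → B → Set} (f : A → B) →
  (∀ {x y} → P x → P y → R x y → S (f x) (f y)) → ∀ {xs} → All P xs → AllPairs R xs → AllPairs S (map f xs)
AllPairs-map⁺ f g []         []         = []
AllPairs-map⁺ f g (px ∷ pxs) (rx ∷ rxs) =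
  All.map⁺ (All.zipWith (λ (py , r) → g px py r) (pxs , rx)) ∷ AllPairs-map⁺ f g pxs rxs

Separated⇒Far : ∀ {V : Set} {_~_ : V → V → Set} {p q p′ q′} → Separated _~_ (p , q) (p′ , q′) →
  Far _~_ p p′ × Far _~_ p q′ × Far _~_ q p′ × Far _~_ q q′
Separated⇒Far (≢₁ , ≢₂ , ≢₃ , ≢₄ , ≁₁ , ≁₂ , ≁₃ , ≁₄) = (≢₁ , ≁₁) , (≢₂ , ≁₂) , (≢₃ , ≁₃) , (≢₄ , ≁₄)

Far⇒Separated : ∀ {V : Set} {_~_ : V → V → Set} {p q p′ q′} →
  Far _~_ p p′ → Far _~_ p q′ → Far _~_ q p′ → Far _~_ q q′ → Separated _~_ (p , q) (p′ , q′)
Far⇒Separated (≢₁ , ≁₁) (≢₂ , ≁₂) (≢₃ , ≁₃) (≢₄ , ≁₄) = ≢₁ , ≢₂ , ≢₃ , ≢₄ , ≁₁ , ≁₂ , ≁₃ , ≁₄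

module _ {n : ℕ} {H : SimpleGraph n} where

  Touches : Fin n → Edge H → Set
  Touches z e = fst e ≡ z ⊎ snd e ≡ z

  LAdj⇒common-end : ∀ {e f} → LAdj H e f → ∃ λ z → Touches z e × Touches z f
  LAdj⇒common-end {e} (_ , inj₁ eq)               = fst e , inj₁ refl , inj₁ (sym eq)
  LAdj⇒common-end {e} (_ , inj₂ (inj₁ eq))        = fst e , inj₁ refl , inj₂ (sym eq)
  LAdj⇒common-end {e} (_ , inj₂ (inj₂ (inj₁ eq))) = snd e , inj₂ refl , inj₁ (sym eq)
  LAdj⇒common-end {e} (_ , inj₂ (inj₂ (inj₂ eq))) = snd e , inj₂ refl , inj₂ (sym eq)

  common-end⇒LAdj : ∀ {e f z} → e ≢ f → Touches z e → Touches z f → LAdj H e f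
  common-end⇒LAdj e≢f (inj₁ p) (inj₁ q) = e≢f , inj₁ (trans p (sym q))
  common-end⇒LAdj e≢f (inj₁ p) (inj₂ q) = e≢f , inj₂ (inj₁ (trans p (sym q)))
  common-end⇒LAdj e≢f (inj₂ p) (inj₁ q) = e≢f , inj₂ (inj₂ (inj₁ (trans p (sym q))))
  common-end⇒LAdj e≢f (inj₂ p) (inj₂ q) = e≢f , inj₂ (inj₂ (inj₂ (trans p (sym q))))

  LAdj-sym : ∀ {e f} → LAdj H e f → LAdj H f e
  LAdj-sym (e≢f , share) with LAdj⇒common-end (e≢f , share)
  ... | (z , ze , zf) = common-end⇒LAdj (≢-sym e≢f) zf ze

  Far-LAdj-sym : ∀ {e f} → Far (LAdj H) e f → Far (LAdj H) f e
  Far-LAdj-sym (e≢f , e≁f) = ≢-sym e≢f , e≁f ∘ LAdj-sym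

  Edge-≡ : ∀ {e f : Edge H} → fst e ≡ fst f → snd e ≡ snd f → e ≡ f
  Edge-≡ {edge a b a<b ab} {edge .a .b a<b′ ab′} refl refl
    rewrite <-irrelevant a<b a<b′ | Decidable⇒UIP.≡-irrelevant Bool._≟_ ab ab′ = refl

  SamePair⇒Edge-≡ : ∀ {e f : Edge H} → SamePair (fst e) (snd e) (fst f) (snd f) → e ≡ f
  SamePair⇒Edge-≡         (inj₁ (p , q))       = Edge-≡ (sym p) (sym q)
  SamePair⇒Edge-≡ {e} {f} (inj₂ (refl , refl)) = contradiction (<-trans (ord e) (ord f)) (<-irrefl refl)

  _≟ᴱ_ : DecidableEquality (Edge H)
  e ≟ᴱ f = Dec.map′ (λ (p , q) → Edge-≡ p q) (λ { refl → refl , refl }) ((fst e ≟ fst f) ×-dec (snd e ≟ snd f))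

  LAdj? : ∀ e f → Dec (LAdj H e f)
  LAdj? e f = ¬? (e ≟ᴱ f) ×-dec (fst e ≟ fst f ⊎-dec fst e ≟ snd f ⊎-dec snd e ≟ fst f ⊎-dec snd e ≟ snd f)

  edgeBetween : ∀ {x y} → Adj H x y → Σ (Edge H) λ e → SamePair x y (fst e) (snd e)
  edgeBetween {x} {y} xy with <-cmp x y
  ... | tri< x<y _ _ = edge x y x<y xy , inj₁ (refl , refl)
  ... | tri≈ _ x≡y _ = contradiction x≡y (Adj⇒≢ H xy)
  ... | tri> _ _ y<x = edge y x y<x (Adj-sym H xy) , inj₂ (refl , refl)

  Edge-searchable : Searchable (Edge H)
  Edge-searchable P P? = Dec.map′ (λ (a , b , (a<b , ab) , p) → edge a b a<b ab , p)
                                  (λ (e , p) → fst e , snd e , (ord e , isEdge e) , p)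
                                  (any? λ a → any? λ b → edgeAt a b)
    where
    edgeAt : ∀ a b → Dec (Σ (a < b × Adj H a b) λ (a<b , ab) → P (edge a b a<b ab))
    edgeAt a b with (a <? b) ×-dec (adj H a b Bool.≟ true)
    ... | no  ¬edge           = no (¬edge ∘ proj₁)
    ... | yes (a<b , ab) = Dec.map′ ((a<b , ab) ,_) (λ (_ , p) → subst P (Edge-≡ refl refl) p) (P? (edge a b a<b ab))

module Contraction {n n′} {G : SimpleGraph n} {G′ : SimpleGraph n′} {u v : Fin n} (uv : Adj G u v)
  (φ : Fin n → Fin n′) (φu≡φv : φ u ≡ φ v)
  (fibres : ∀ x y → φ x ≡ φ y → x ≡ y ⊎ ((x ≡ u ⊎ x ≡ v) × (y ≡ u ⊎ y ≡ v)))
  (Adj-lift : ∀ {a b} → Adj G′ a b → ∃ λ x → ∃ λ y → φ x ≡ a × φ y ≡ b × Adj G x y) where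

  centre : Fin n′
  centre = φ u

  LiesOver : Edge G → Edge G′ → Set
  LiesOver e r = SamePair (fst r) (snd r) (φ (fst e)) (φ (snd e))

  lift : ∀ r → Σ (Edge G) λ e → LiesOver e r
  lift r =
    let (x , y , φx , φy , xy) = Adj-lift (isEdge r)
        (e , e≈xy)            = edgeBetween xy
    in e , subst₂ (λ a b → SamePair a b (φ (fst e)) (φ (snd e))) φx φy (SamePair-map φ e≈xy)

  ψ : Edge G′ → Edge G
  ψ = proj₁ ∘ lift

  ψ-liesOver : ∀ r → LiesOver (ψ r) r
  ψ-liesOver = proj₂ ∘ lift

  LiesOver⇒φ≢ : ∀ {e r} → LiesOver e r → φ (fst e) ≢ φ (snd e)
  LiesOver⇒φ≢ {r = r} (inj₁ (p , q)) eq = <⇒≢ (ord r) (trans (sym p) (trans eq q))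
  LiesOver⇒φ≢ {r = r} (inj₂ (p , q)) eq = <⇒≢ (ord r) (trans (sym q) (trans (sym eq) p))

  LiesOver-unique : ∀ {e r s} → LiesOver e r → LiesOver e s → r ≡ s
  LiesOver-unique e/r e/s = SamePair⇒Edge-≡ (SamePair-trans e/r (SamePair-sym e/s))

  ψ-injective : ∀ {r s} → ψ r ≡ ψ s → r ≡ s
  ψ-injective {r} {s} eq = LiesOver-unique {ψ r} (ψ-liesOver r) (subst (λ e → LiesOver e s) (sym eq) (ψ-liesOver s))

  ψ-touches : ∀ r {z} → Touches z (ψ r) → Touches (φ z) r
  ψ-touches r = SamePair-∈ (ψ-liesOver r) ∘ Sum.map (cong φ) (cong φ)

  ψ-touched : ∀ r {c} → Touches c r → ∃ λ x → Touches x (ψ r) × φ x ≡ c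
  ψ-touched r = [ (λ p → fst (ψ r) , inj₁ refl , p) , (λ p → snd (ψ r) , inj₂ refl , p) ]′
                ∘ SamePair-∈ (SamePair-sym (ψ-liesOver r))

  euv : Edge G
  euv = proj₁ (edgeBetween uv)

  touches-euv : ∀ {z} → Touches z euv → z ≡ u ⊎ z ≡ v
  touches-euv = Sum.map sym sym ∘ SamePair-∈ (proj₂ (edgeBetween uv))

  euv-touches : ∀ {z} → z ≡ u ⊎ z ≡ v → Touches z euv
  euv-touches = SamePair-∈ (SamePair-sym (proj₂ (edgeBetween uv))) ∘ Sum.map sym sym

  φ-uv : ∀ {z} → z ≡ u ⊎ z ≡ v → φ z ≡ centre
  φ-uv = [ cong φ , (λ z≡v → trans (cong φ z≡v) (sym φu≡φv)) ]′

  ψ≢euv : ∀ r → ψ r ≢ euv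
  ψ≢euv r eq = LiesOver⇒φ≢ {euv} {r} (subst (λ e → LiesOver e r) eq (ψ-liesOver r))
    (trans (φ-uv (touches-euv {fst euv} (inj₁ refl))) (sym (φ-uv (touches-euv {snd euv} (inj₂ refl)))))

  Far-ψ : ∀ {r s} → Far (LAdj G′) r s → Far (LAdj G) (ψ r) (ψ s)
  Far-ψ {r} {s} (r≢s , r≁s) = r≢s ∘ ψ-injective , λ ψr~ψs →
    let (z , zr , zs) = LAdj⇒common-end ψr~ψs
    in r≁s (common-end⇒LAdj r≢s (ψ-touches r zr) (ψ-touches s zs))

  Far-euv : ∀ {r s} → Far (LAdj G′) r s → Touches centre s → Far (LAdj G) (ψ r) euv
  Far-euv {r} {s} (r≢s , r≁s) cs = ψ≢euv r , λ ψr~euv →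
    let (z , zr , ze) = LAdj⇒common-end ψr~euv
        cr = subst (λ c → Touches c r) (φ-uv (touches-euv ze)) (ψ-touches r zr)
    in r≁s (common-end⇒LAdj r≢s cr cs)

  Far⇒centre-once : ∀ {r s} → Far (LAdj G′) r s → Touches centre r → ¬ Touches centre s
  Far⇒centre-once (r≢s , r≁s) cr cs = r≁s (common-end⇒LAdj r≢s cr cs)

  -- The common end of p and q has two distinct preimages, so it is the contracted vertex.
  lift-broken : ∀ {p q} → LAdj G′ p q → ¬ LAdj G (ψ p) (ψ q) →
    Touches centre p × Touches centre q × LAdj G euv (ψ q) × LAdj G (ψ p) euv
  lift-broken {p} {q} p~q ψp≁ψq =
    let (c , cp , cq)  = LAdj⇒common-end p~q
        (x , xp , φx) = ψ-touched p cp
        (y , yq , φy) = ψ-touched q cq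
    in case fibres x y (trans φx (sym φy)) of λ where
      (inj₁ x≡y) →
        let yp = subst (λ z → Touches z (ψ p)) x≡y xp
        in contradiction (common-end⇒LAdj (proj₁ p~q ∘ ψ-injective) yp yq) ψp≁ψq
      (inj₂ (x∈uv , y∈uv)) →
          subst (λ z → Touches z p) (trans (sym φx) (φ-uv x∈uv)) cp
        , subst (λ z → Touches z q) (trans (sym φy) (φ-uv y∈uv)) cq
        , common-end⇒LAdj (≢-sym (ψ≢euv q)) (euv-touches y∈uv) yq
        , common-end⇒LAdj (ψ≢euv p) xp (euv-touches x∈uv)

  module _ (X : Edge G → Set) (X′ : Edge G′ → Set) (X′⇔X∘ψ : ∀ r → X′ r ⇔ X (ψ r)) where

    -- A pair whose lift is not adjacent in L(G) is repaired by using euv on whichever side of the cut euv lies.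
    liftPair : Dec (X euv) → Edge G′ × Edge G′ → Edge G × Edge G
    liftPair _ (p , q) with LAdj? (ψ p) (ψ q)
    ... | yes _ = ψ p , ψ q
    liftPair (yes _) (p , q) | no _ = euv , ψ q
    liftPair (no _)  (p , q) | no _ = ψ p , euv

    liftPair-cross : ∀ X-euv? P → CrossEdge (LAdj G′) X′ P → CrossEdge (LAdj G) X (liftPair X-euv? P)
    liftPair-cross _ (p , q) (X′p , ¬X′q , p~q) with LAdj? (ψ p) (ψ q)
    ... | yes ψp~ψq = to (X′⇔X∘ψ p) X′p , ¬X′q ∘ from (X′⇔X∘ψ q) , ψp~ψq
    liftPair-cross (yes X-euv) (p , q) (X′p , ¬X′q , p~q) | no ψp≁ψq =
      X-euv , ¬X′q ∘ from (X′⇔X∘ψ q) , proj₁ (proj₂ (proj₂ (lift-broken p~q ψp≁ψq)))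
    liftPair-cross (no ¬X-euv) (p , q) (X′p , ¬X′q , p~q) | no ψp≁ψq =
      to (X′⇔X∘ψ p) X′p , ¬X-euv , proj₂ (proj₂ (proj₂ (lift-broken p~q ψp≁ψq)))

    LiftCandidate : Edge G′ × Edge G′ → Edge G → Set
    LiftCandidate (p , q) e = e ≡ ψ p ⊎ e ≡ ψ q ⊎ (¬ LAdj G (ψ p) (ψ q) × e ≡ euv)

    liftPair-candidates : ∀ X-euv? P → LiftCandidate P (proj₁ (liftPair X-euv? P)) × LiftCandidate P (proj₂ (liftPair X-euv? P))
    liftPair-candidates _ (p , q) with LAdj? (ψ p) (ψ q)
    ... | yes _ = inj₁ refl , inj₂ (inj₁ refl)
    liftPair-candidates (yes _) (p , q) | no ψp≁ψq = inj₂ (inj₂ (ψp≁ψq , refl)) , inj₂ (inj₁ refl)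
    liftPair-candidates (no _)  (p , q) | no ψp≁ψq = inj₁ refl , inj₂ (inj₂ (ψp≁ψq , refl))

    candidates-far : ∀ {p q p′ q′} → LAdj G′ p q → LAdj G′ p′ q′ → Separated (LAdj G′) (p , q) (p′ , q′) →
      ∀ {e f} → LiftCandidate (p , q) e → LiftCandidate (p′ , q′) f → Far (LAdj G) e f
    candidates-far {p} {q} {p′} {q′} p~q p′~q′ separated = go
      where
      pp′ = proj₁ (Separated⇒Far separated)
      pq′ = proj₁ (proj₂ (Separated⇒Far separated))
      qp′ = proj₁ (proj₂ (proj₂ (Separated⇒Far separated)))
      qq′ = proj₂ (proj₂ (proj₂ (Separated⇒Far separated)))
      centre-p  = λ broken → proj₁ (lift-broken p~q broken)
      centre-p′ = λ broken → proj₁ (lift-broken p′~q′ broken)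
      go : ∀ {e f} → LiftCandidate (p , q) e → LiftCandidate (p′ , q′) f → Far (LAdj G) e f
      go (inj₁ refl)          (inj₁ refl)                   = Far-ψ pp′
      go (inj₁ refl)          (inj₂ (inj₁ refl))            = Far-ψ pq′
      go (inj₁ refl)          (inj₂ (inj₂ (b′ , refl)))     = Far-euv pp′ (centre-p′ b′)
      go (inj₂ (inj₁ refl))   (inj₁ refl)                   = Far-ψ qp′
      go (inj₂ (inj₁ refl))   (inj₂ (inj₁ refl))            = Far-ψ qq′
      go (inj₂ (inj₁ refl))   (inj₂ (inj₂ (b′ , refl)))     = Far-euv qp′ (centre-p′ b′)
      go (inj₂ (inj₂ (b , refl))) (inj₁ refl)               = Far-LAdj-sym (Far-euv (Far-LAdj-sym pp′) (centre-p b))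
      go (inj₂ (inj₂ (b , refl))) (inj₂ (inj₁ refl))        = Far-LAdj-sym (Far-euv (Far-LAdj-sym pq′) (centre-p b))
      go (inj₂ (inj₂ (b , refl))) (inj₂ (inj₂ (b′ , refl))) = contradiction (centre-p′ b′) (Far⇒centre-once pp′ (centre-p b))

    liftPair-separated : ∀ X-euv? {P P′} → CrossEdge (LAdj G′) X′ P → CrossEdge (LAdj G′) X′ P′ →
      Separated (LAdj G′) P P′ → Separated (LAdj G) (liftPair X-euv? P) (liftPair X-euv? P′)
    liftPair-separated X-euv? {P} {P′} (_ , _ , p~q) (_ , _ , p′~q′) separated =
      let (e₁ , f₁) = liftPair-candidates X-euv? P
          (e₂ , f₂) = liftPair-candidates X-euv? P′
          far = candidates-far p~q p′~q′ separated
      in Far⇒Separated {_~_ = LAdj G} (far e₁ e₂) (far e₁ f₂) (far f₁ e₂) (far f₁ f₂)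

    liftMatching : ∀ X-euv? {M} → IsInducedCrossMatching (LAdj G′) X′ M →
      IsInducedCrossMatching (LAdj G) X (map (liftPair X-euv?) M)
    liftMatching X-euv? (cross , separated) =
        All.map⁺ (All.map (liftPair-cross X-euv? _) cross)
      , AllPairs-map⁺ (liftPair X-euv?) (liftPair-separated X-euv?) cross separated

    -- Which side of the cut euv lies on need not be decidable, but the goal is, so it is stable under ¬¬.
    CutsimLE-lift : ∀ {k} → CutsimLE (LAdj G) X k → CutsimLE (LAdj G′) X′ k
    CutsimLE-lift {k} bound M matching = decidable-stable (length M ≤? k) λ M≰k →
      ¬¬-excluded-middle λ X-euv? →
        M≰k (subst (_≤ k) (length-map (liftPair X-euv?) M) (bound _ (liftMatching X-euv? matching)))

lemma4p1 : ∀ (n : ℕ) (G : SimpleGraph n) → AtLeastThreeEdges G →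
    ∀ (n' : ℕ) (G' : SimpleGraph n') → IsEdgeContraction G G' →
    ∀ (k : ℕ) → simwLineLE G k → simwLineLE G' k
lemma4p1 n G _ n′ G′ (u , v , uv , φ , _ , φu≡φv , fibres , adjacency) k =
  SimwLE-reflect ψ ψ-injective _≟ᴱ_ Edge-searchable (λ X X′ X′⇔X∘ψ → CutsimLE-lift X X′ X′⇔X∘ψ)
  where
  open Contraction {G = G} {G′ = G′} uv φ φu≡φv fibres (λ {a} {b} ab → proj₂ (proj₁ (adjacency a b) ab))
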